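{- (1) For every type $\alpha$, the relation $\equiv_\alpha$ is an equivalence relation on the set of EAMs of type $\alpha$. (2) If $\mathsf M:\alpha$, $\mathsf N:\alpha$ and $\mathsf M\to_{\mathsf c}\mathsf N$, then $\mathsf M\equiv_\alpha\mathsf N$. (3) If $\mathsf M:\alpha\to\beta$, $\mathsf N_1:\alpha$, $\mathsf N_2:\alpha$ and $\mathsf N_1\to_{\mathsf c}\mathsf N_2$, then $\mathsf M@[\#\mathsf N_1]\equiv_\beta\mathsf M@[\#\mathsf N_2]$.
   Context: EAMs. Countably infinite address set $\mathbb A\supseteq\mathbb N$ with $\mathbb A\setminus\mathbb N$ infinite, null $\varnothing\notin\mathbb A$; tapes are finite lists of addresses ($a::T$, $T@T'$). Programs: $P::=\mathtt{Load}\,i;P\mid A$, $A::=\mathtt{App}(i,j,k);A\mid\mathtt{Test}(i,j,k,l);A\mid\mathtt{Pred}(i,j);A\mid\mathtt{Succ}(i,j);A\mid C$, $C::=\mathtt{Call}\,i\mid\varepsilon$. An EAM is $\langle R_0,\dots,R_r,P,T\rangle$ with $!R_i\in\mathbb A\cup\{\varnothing\}$ and valid program (no read of uninitialised/nonexistent register, no App/Pred/Succ/Test write to nonexistent register; Load into nonexistent register discards). $\mathsf M@T'$ appends to the tape. $\mathsf n=\langle R_0=n,\varepsilon,[]\rangle$; $\mathsf Y^a=\langle R_0=\varnothing,R_1=\varnothing,\mathtt{Load}\,0;\mathtt{Load}\,1;\mathtt{App}(0,1,0);\mathtt{App}(1,0,1);\mathtt{Call}\,1,[a]\rangle$; fixed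 bijection $\#$ from EAMs onto $\mathbb A$ with $\#\mathsf n=n$ and $\#\mathsf Y^a=a$ for some $a\notin\mathbb N$ (machine $\mathsf Y$); $a\cdot b=\#(\#^{ -1}(a)@[b])$. Reduction $\to_{\mathsf c}$: $\mathtt{Call}\,i$ with tape $T$ becomes $\#^{ -1}(!R_i)@T$; $\mathtt{Load}\,i$ pops the tape head into $R_i$; $\mathtt{App}(i,j,k)$ sets $R_k:=!R_i\cdot!R_j$; if $!R_i\in\mathbb N$, $\mathtt{Pred}(i,j)$ sets $R_j:=\max(!R_i-1,0)$, $\mathtt{Succ}(i,j)$ sets $R_j:=!R_i+1$, $\mathtt{Test}(i,j,k,l)$ sets $R_l:=!R_j$ if $!R_i=0$, else $!R_k$ (each consuming the instruction); if instead $\#^{ -1}(!R_i)\to_{\mathsf c}\mathsf M'$ and the first instruction is one of these three, the machine steps by setting $R_i:=\#\mathsf M'$. $\twoheadrightarrow_{\mathsf c}$ reflexive-transitive closure. EAM typing $\mathsf M:\alpha$ (types $\alpha::=\mathsf{int}\mid\alpha\to\beta$): least relations with $\mathsf n:\mathsf{int}$; $\mathsf Y:(\alpha\to\alpha)\to\alpha$; $\langle R_0..R_r,P,T\rangle:\alpha$ if $R_0..R_r\models\Delta$ and $\Delta\Vdash^r(P,T):\alpha$, where ($\Delta$ finite map indices$\to$types, $\Delta[i:\alpha]$ update): empty$\models$empty; $R_0..R_{r-1}\models\Delta$ with $!R_r=\varnothing$ gives $R_0..R_r\models\Delta$; with $\#^{ -1}(!R_r):\alpha$ gives $R_0..R_r\models\Delta,r:\alpha$;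 $\Delta[i:\beta]\Vdash^r(P,[]):\alpha\Rightarrow\Delta\Vdash^r(\mathtt{Load}\,i;P,[]):\beta\to\alpha$; $\Delta[i:\beta]\Vdash^r(P,T):\alpha$ and $\#^{ -1}(a):\beta\Rightarrow\Delta\Vdash^r(\mathtt{Load}\,i;P,a::T):\alpha$; $(\Delta,i:\mathsf{int})[j:\mathsf{int}]\Vdash^r(P,T):\alpha\Rightarrow\Delta,i:\mathsf{int}\Vdash^r(\mathtt{Pred}(i,j);P,T):\alpha$, same for $\mathtt{Succ}$; $(\Delta,i:\mathsf{int},j:\beta,k:\beta)[l:\beta]\Vdash^r(P,T):\alpha\Rightarrow\Delta,i:\mathsf{int},j:\beta,k:\beta\Vdash^r(\mathtt{Test}(i,j,k,l);P,T):\alpha$; $(\Delta,i:\alpha\to\beta,j:\alpha)[k:\beta]\Vdash^r(P,T):\delta\Rightarrow\Delta,i:\alpha\to\beta,j:\alpha\Vdash^r(\mathtt{App}(i,j,k);P,T):\delta$; $\mathsf M_1:\alpha_1..\mathsf M_n:\alpha_n\Rightarrow\Delta,i:\alpha_1\to\cdots\to\alpha_n\to\alpha\Vdash^r(\mathtt{Call}\,i,[\#\mathsf M_1..\#\mathsf M_n]):\alpha$. Equivalence. $\mathcal D_\alpha=\{a\in\mathbb A:\#^{ -1}(a):\alpha\}$. For EAMs of type $\alpha$: $\mathsf M\equiv_{\mathsf{int}}\mathsf N$ iff $\forall n$ ($\mathsf M\twoheadrightarrow_{\mathsf c}\mathsf n\iff\mathsf N\twoheadrightarrow_{\mathsf c}\mathsf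 n$); $\mathsf M\equiv_{\alpha\to\beta}\mathsf N$ iff for all $a,b\in\mathcal D_\alpha$ with $\#^{ -1}(a)\equiv_\alpha\#^{ -1}(b)$, $\mathsf M@[a]\equiv_\beta\mathsf N@[b]$. -}

module Defs where

open import Data.Nat using (ℕ; zero; suc; _∸_; _<ᵇ_)
open import Data.Bool using (Bool; true; false; _∧_; not; T)
open import Data.Maybe using (Maybe; just; nothing; is-just)
open import Data.List using (List; []; _∷_; _++_; [_]; map; length; null; _∷ʳ_)
open import Data.List.Relation.Binary.Pointwise using (Pointwise)
open import Data.Product using (Σ; _×_; _,_)
open import Data.Empty using (⊥)
open import Relation.Nullary using (¬_)
open import Relation.Nullary.Decidable using (⌊_⌋)
open import Relation.Binary.PropositionalEquality using (_≡_)
open import Relation.Binary.Construct.Closure.ReflexiveTransitive using (Star)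
open import Function.Bundles using (Inverse; _⇔_)
open import Function.Definitions using (Injective)
import Data.Nat as N

getR : {X : Set} → List X → ℕ → Maybe X
getR []       _       = nothing
getR (x ∷ xs) zero    = just x
getR (x ∷ xs) (suc i) = getR xs i

-- writing to a nonexistent register is a no-op (discard)
setR : {X : Set} → List X → ℕ → X → List X
setR []       _       y = []
setR (x ∷ xs) zero    y = y ∷ xs
setR (x ∷ xs) (suc i) y = x ∷ setR xs i y

-- Programs:  P ::= Load i ; P | A
--            A ::= App(i,j,k);A | Test(i,j,k,l);A | Pred(i,j);A | Succ(i,j);A | C
--            C ::= Call i | ε

data Body : Set where
  app  : ℕ → ℕ → ℕ → Body → Body
  test : ℕ → ℕ → ℕ → ℕ → Body → Body
  pred : ℕ → ℕ → Body → Body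
  succ : ℕ → ℕ → Body → Body
  call : ℕ → Body
  stop : Body

data Prog : Set where
  load : ℕ → Prog → Prog
  body : Body → Prog

-- Validity (static): no read of an uninitialised / nonexistent register,
-- no App/Pred/Succ/Test write to a nonexistent register.
-- 'init' records, for each existing register, whether it is initialised.

rdB : List Bool → ℕ → Bool
rdB bs i with getR bs i
... | just b  = b
... | nothing = false

exB : List Bool → ℕ → Bool
exB bs i = i <ᵇ length bs

validB : List Bool → Body → Bool
validB ini (app i j k b)    = rdB ini i ∧ rdB ini j ∧ exB ini k ∧ validB (setR ini k true) b
validB ini (test i j k l b) = rdB ini i ∧ rdB ini j ∧ rdB ini k ∧ exB ini l ∧ validB (setR ini l true) b
validB ini (pred i j b)     = rdB ini i ∧ exB ini j ∧ validB (setR ini j true) b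
validB ini (succ i j b)     = rdB ini i ∧ exB ini j ∧ validB (setR ini j true) b
validB ini (call i)         = rdB ini i
validB ini stop             = true

validP : List Bool → Prog → Bool
validP ini (load i p) = validP (setR ini i true) p   -- Load into nonexistent register discards
validP ini (body b)   = validB ini b

infixr 5 _⇒_
data Ty : Set where
  int : Ty
  _⇒_ : Ty → Ty → Ty

-- The address set: countably infinite 𝔸 ⊇ ℕ with 𝔸 ∖ ℕ infinite.
-- ℕ ⊆ 𝔸 is given by the injection ι; the null value ∅ is 'nothing'.

record AddrSpace : Set₁ where
  field
    𝔸        : Set
    ι        : ℕ → 𝔸
    ι-inj    : Injective _≡_ _≡_ ι
    count    : Inverse (Relation.Binary.PropositionalEquality.setoid 𝔸)
                       (Relation.Binary.PropositionalEquality.setoid ℕ)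
    fresh    : ℕ → 𝔸
    fresh-inj : Injective _≡_ _≡_ fresh
    fresh∉ℕ  : ∀ m n → ¬ (fresh m ≡ ι n)

module Machines (S : AddrSpace) where
  open AddrSpace S

  Tape : Set
  Tape = List 𝔸

  Regs : Set
  Regs = List (Maybe 𝔸)

  record Raw : Set where
    constructor ⟨_,_,_⟩
    field
      regs : Regs
      prog : Prog
      tape : Tape

  validRaw : Raw → Bool
  validRaw ⟨ rs , p , t ⟩ = not (null rs) ∧ validP (map is-just rs) p

  record EAM : Set where
    constructor mk
    field
      raw   : Raw
      valid : T (validRaw raw)
  open EAM public

  _＠_ : EAM → Tape → EAM
  mk ⟨ rs , p , t ⟩ v ＠ t' = mk ⟨ rs , p , t ++ t' ⟩ v

  num : ℕ → EAM
  num n = mk ⟨ just (ι n) ∷ [] , body stop , [] ⟩ _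

  Ymach : 𝔸 → EAM
  Ymach a = mk ⟨ nothing ∷ nothing ∷ [] ,
                 load 0 (load 1 (body (app 0 1 0 (app 1 0 1 (call 1))))) ,
                 a ∷ [] ⟩ _

record Coding (S : AddrSpace) : Set₁ where
  open AddrSpace S
  open Machines S
  field
    enc     : EAM → 𝔸
    dec     : 𝔸 → EAM
    dec-enc : ∀ M → dec (enc M) ≡ M
    enc-dec : ∀ a → enc (dec a) ≡ a
    enc-num : ∀ n → enc (num n) ≡ ι n
    yA      : 𝔸
    yA∉ℕ    : ∀ n → ¬ (yA ≡ ι n)
    enc-Y   : enc (Ymach yA) ≡ yA

module Sem (S : AddrSpace) (C : Coding S) where
  open AddrSpace S
  open Machines S public
  open Coding C public

  𝖸 : EAM
  𝖸 = Ymach yA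

  _·_ : 𝔸 → 𝔸 → 𝔸
  a · b = enc (dec a ＠ [ b ])

  -- One-step reduction →c (the target carries its own validity proof;
  -- the constructors fix its underlying raw machine).

  infix 4 _⟶_
  data _⟶_ (M : EAM) : EAM → Set where
    load  : ∀ {N i p a t} →
            Raw.prog (raw M) ≡ load i p → Raw.tape (raw M) ≡ a ∷ t →
            raw N ≡ ⟨ setR (Raw.regs (raw M)) i (just a) , p , t ⟩ → M ⟶ N
    app   : ∀ {N i j k b a a'} →
            Raw.prog (raw M) ≡ body (app i j k b) →
            getR (Raw.regs (raw M)) i ≡ just (just a) →
            getR (Raw.regs (raw M)) j ≡ just (just a') →
            raw N ≡ ⟨ setR (Raw.regs (raw M)) k (just (a · a')) , body b , Raw.tape (raw M) ⟩ →
            M ⟶ N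
    predN : ∀ {N i j b n} →
            Raw.prog (raw M) ≡ body (pred i j b) →
            getR (Raw.regs (raw M)) i ≡ just (just (ι n)) →
            raw N ≡ ⟨ setR (Raw.regs (raw M)) j (just (ι (n ∸ 1))) , body b , Raw.tape (raw M) ⟩ →
            M ⟶ N
    succN : ∀ {N i j b n} →
            Raw.prog (raw M) ≡ body (succ i j b) →
            getR (Raw.regs (raw M)) i ≡ just (just (ι n)) →
            raw N ≡ ⟨ setR (Raw.regs (raw M)) j (just (ι (suc n))) , body b , Raw.tape (raw M) ⟩ →
            M ⟶ N
    testZ : ∀ {N i j k l b c} →
            Raw.prog (raw M) ≡ body (test i j k l b) →
            getR (Raw.regs (raw M)) i ≡ just (just (ι 0)) →
            getR (Raw.regs (raw M)) j ≡ just (just c) →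
            raw N ≡ ⟨ setR (Raw.regs (raw M)) l (just c) , body b , Raw.tape (raw M) ⟩ →
            M ⟶ N
    testS : ∀ {N i j k l b n c} →
            Raw.prog (raw M) ≡ body (test i j k l b) →
            getR (Raw.regs (raw M)) i ≡ just (just (ι (suc n))) →
            getR (Raw.regs (raw M)) k ≡ just (just c) →
            raw N ≡ ⟨ setR (Raw.regs (raw M)) l (just c) , body b , Raw.tape (raw M) ⟩ →
            M ⟶ N
    -- the tested register holds a (non-numeral) machine which steps
    predR : ∀ {N M' i j b a} →
            Raw.prog (raw M) ≡ body (pred i j b) →
            getR (Raw.regs (raw M)) i ≡ just (just a) → dec a ⟶ M' →
            raw N ≡ ⟨ setR (Raw.regs (raw M)) i (just (enc M')) , Raw.prog (raw M) , Raw.tape (raw M) ⟩ →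
            M ⟶ N
    succR : ∀ {N M' i j b a} →
            Raw.prog (raw M) ≡ body (succ i j b) →
            getR (Raw.regs (raw M)) i ≡ just (just a) → dec a ⟶ M' →
            raw N ≡ ⟨ setR (Raw.regs (raw M)) i (just (enc M')) , Raw.prog (raw M) , Raw.tape (raw M) ⟩ →
            M ⟶ N
    testR : ∀ {N M' i j k l b a} →
            Raw.prog (raw M) ≡ body (test i j k l b) →
            getR (Raw.regs (raw M)) i ≡ just (just a) → dec a ⟶ M' →
            raw N ≡ ⟨ setR (Raw.regs (raw M)) i (just (enc M')) , Raw.prog (raw M) , Raw.tape (raw M) ⟩ →
            M ⟶ N
    callS : ∀ {N i a} →
            Raw.prog (raw M) ≡ body (call i) →
            getR (Raw.regs (raw M)) i ≡ just (just a) →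
            N ≡ dec a ＠ Raw.tape (raw M) →
            M ⟶ N

  infix 4 _⟶*_
  _⟶*_ : EAM → EAM → Set
  _⟶*_ = Star _⟶_

  -- contexts Δ : finite maps indices → types (only finite ones arise)
  Ctx : Set
  Ctx = ℕ → Maybe Ty

  ∅ctx : Ctx
  ∅ctx _ = nothing

  _[_∶=_] : Ctx → ℕ → Ty → Ctx
  (Δ [ i ∶= α ]) j with ⌊ j N.≟ i ⌋
  ... | true  = just α
  ... | false = Δ j

  _⇒*_ : List Ty → Ty → Ty
  []       ⇒* α = α
  (β ∷ βs) ⇒* α = β ⇒ (βs ⇒* α)

  infix 4 _⦂_ _⊨_ _⊩[_]_⦂_
  data _⦂_ : EAM → Ty → Set
  data _⊨_ : Regs → Ctx → Set
  data _⊩[_]_⦂_ : Ctx → ℕ → Prog × Tape → Ty → Set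

  data _⦂_ where
    numT : ∀ n → num n ⦂ int
    YT   : ∀ α → 𝖸 ⦂ ((α ⇒ α) ⇒ α)
    eamT : ∀ {M Δ α} → Raw.regs (raw M) ⊨ Δ →
           Δ ⊩[ length (Raw.regs (raw M)) ∸ 1 ] (Raw.prog (raw M) , Raw.tape (raw M)) ⦂ α →
           M ⦂ α

  data _⊨_ where
    emptyR : [] ⊨ ∅ctx
    nullR  : ∀ {R Δ} → R ⊨ Δ → (R ∷ʳ nothing) ⊨ Δ
    valR   : ∀ {R Δ a α} → R ⊨ Δ → dec a ⦂ α → (R ∷ʳ just a) ⊨ (Δ [ length R ∶= α ])

  data _⊩[_]_⦂_ where
    loadE : ∀ {Δ r i p β α} → (Δ [ i ∶= β ]) ⊩[ r ] (p , []) ⦂ α →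
            Δ ⊩[ r ] (load i p , []) ⦂ (β ⇒ α)
    loadT : ∀ {Δ r i p a t β α} → (Δ [ i ∶= β ]) ⊩[ r ] (p , t) ⦂ α → dec a ⦂ β →
            Δ ⊩[ r ] (load i p , a ∷ t) ⦂ α
    predT : ∀ {Δ r i j b t α} → Δ i ≡ just int →
            (Δ [ j ∶= int ]) ⊩[ r ] (body b , t) ⦂ α →
            Δ ⊩[ r ] (body (pred i j b) , t) ⦂ α
    succT : ∀ {Δ r i j b t α} → Δ i ≡ just int →
            (Δ [ j ∶= int ]) ⊩[ r ] (body b , t) ⦂ α →
            Δ ⊩[ r ] (body (succ i j b) , t) ⦂ α
    testT : ∀ {Δ r i j k l b t β α} → Δ i ≡ just int → Δ j ≡ just β → Δ k ≡ just β →
            (Δ [ l ∶= β ]) ⊩[ r ] (body b , t) ⦂ α →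
            Δ ⊩[ r ] (body (test i j k l b) , t) ⦂ α
    appT  : ∀ {Δ r i j k b t α β δ} → Δ i ≡ just (α ⇒ β) → Δ j ≡ just α →
            (Δ [ k ∶= β ]) ⊩[ r ] (body b , t) ⦂ δ →
            Δ ⊩[ r ] (body (app i j k b) , t) ⦂ δ
    callT : ∀ {Δ r i t αs α} → Pointwise (λ a β → dec a ⦂ β) t αs →
            Δ i ≡ just (αs ⇒* α) →
            Δ ⊩[ r ] (body (call i) , t) ⦂ α

  𝒟 : Ty → 𝔸 → Set
  𝒟 α a = dec a ⦂ α

  Equiv : Ty → EAM → EAM → Set
  Equiv int     M N = ∀ n → (M ⟶* num n) ⇔ (N ⟶* num n)
  Equiv (α ⇒ β) M N = ∀ a b → 𝒟 α a → 𝒟 α b → Equiv α (dec a) (dec b) →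
                      Equiv β (M ＠ [ a ]) (N ＠ [ b ])

  Typed : Ty → Set
  Typed α = Σ EAM (λ M → M ⦂ α)

-- Everything rests on reflexivity of ≡_α on typed machines: (2) follows from it
-- because reduction is deterministic, so a machine reaches a numeral iff its reduct
-- does, and (3) is reflexivity of M applied to the equivalent arguments #N₁ and #N₂.
-- Reflexivity is proved with a step-indexed logical relation: Approx k α M N says
-- that every numeral M reaches in at most k steps, after being applied to related
-- arguments, is reached by N as well. The index is what makes the fixed-point
-- machine Y go through, since each unfolding of Y costs a step. The fundamental
-- lemma, by induction on typing derivations, shows that every typed machine
-- approximates itself. The delicate instructions are Pred, Succ and Test, which
-- first run the machine held in the inspected register: a run of the whole machine
-- splits into a run of that register to some numeral n, followed by a run of the
-- machine with the register set to n. Finally, mutual approximation at every index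
-- coincides with ≡_α, while symmetry and transitivity are direct.

module Submission where

open import Defs
open import Data.Product using (_×_; proj₁)
open import Data.List using ([_])
open import Relation.Binary.Structures using (IsEquivalence)

open import Data.Nat using (ℕ; zero; suc; _+_; _∸_; _≤_; z≤n; _≟_)
import Data.Nat as ℕ
open import Data.Nat.Properties using (≤-refl; ≤-trans; n≤1+n; m≤m+n; m≤n+m; pred-mono-≤; pred[n]≤n)
open import Data.Bool using (true; not; _∧_; T)
open import Data.Maybe using (Maybe; just; nothing; is-just)
import Data.Maybe as Maybe
open import Data.List using (List; []; _∷_; _++_; _∷ʳ_; map; length; null)
open import Data.List.Properties using (++-assoc; ++-identityʳ; ∷-injectiveʳ)
open import Data.List.Relation.Binary.Pointwise using (Pointwise; []; _∷_)
import Data.List.Relation.Binary.Pointwise as Pointwise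
open import Data.Bool.Properties using (T-irrelevant; T-∧)
open import Function.Base using (_∘_)
open import Function.Bundles using (Equivalence; mk⇔)
open import Data.Product using (∃; ∃₂; _,_; proj₂)
open import Data.Sum using (_⊎_; inj₁; inj₂)
open import Data.Empty using (⊥-elim)
open import Relation.Nullary using (¬_; yes; no)
open import Relation.Binary.PropositionalEquality hiding ([_])
open import Relation.Binary.Construct.Closure.ReflexiveTransitive using (ε; _◅_; _◅◅_)

module _ {X : Set} where

  getR∘setR : ∀ (xs : List X) i {y z} → getR xs i ≡ just z → getR (setR xs i y) i ≡ just y
  getR∘setR (x ∷ xs) zero    _  = refl
  getR∘setR (x ∷ xs) (suc i) eq = getR∘setR xs i eq

  getR∘setR-just : ∀ (xs : List X) i {y z} → getR (setR xs i y) i ≡ just z → z ≡ y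
  getR∘setR-just (x ∷ xs) zero    refl = refl
  getR∘setR-just (x ∷ xs) (suc i) eq   = getR∘setR-just xs i eq

  getR∘setR′ : ∀ (xs : List X) {i l y} → l ≢ i → getR (setR xs i y) l ≡ getR xs l
  getR∘setR′ []       l≢i = refl
  getR∘setR′ (x ∷ xs) {zero}  {zero}  l≢i = ⊥-elim (l≢i refl)
  getR∘setR′ (x ∷ xs) {zero}  {suc l} l≢i = refl
  getR∘setR′ (x ∷ xs) {suc i} {zero}  l≢i = refl
  getR∘setR′ (x ∷ xs) {suc i} {suc l} l≢i = getR∘setR′ xs (λ l≡i → l≢i (cong suc l≡i))

  setR-setR : ∀ (xs : List X) i {y z} → setR (setR xs i y) i z ≡ setR xs i z
  setR-setR []       i       = refl
  setR-setR (x ∷ xs) zero    = refl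
  setR-setR (x ∷ xs) (suc i) = cong (x ∷_) (setR-setR xs i)

  setR-getR : ∀ (xs : List X) i {y} → getR xs i ≡ just y → setR xs i y ≡ xs
  setR-getR (x ∷ xs) zero    refl = refl
  setR-getR (x ∷ xs) (suc i) eq   = cong (x ∷_) (setR-getR xs i eq)

  null-setR : ∀ (xs : List X) i {y} → null (setR xs i y) ≡ null xs
  null-setR []       i       = refl
  null-setR (x ∷ xs) zero    = refl
  null-setR (x ∷ xs) (suc i) = refl

  getR-∷ʳ-length : ∀ (xs : List X) {x} → getR (xs ∷ʳ x) (length xs) ≡ just x
  getR-∷ʳ-length []       = refl
  getR-∷ʳ-length (_ ∷ xs) = getR-∷ʳ-length xs

  getR-∷ʳ-≢ : ∀ (xs : List X) {x i} → i ≢ length xs → getR (xs ∷ʳ x) i ≡ getR xs i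
  getR-∷ʳ-≢ []       {i = zero}  i≢0 = ⊥-elim (i≢0 refl)
  getR-∷ʳ-≢ []       {i = suc i} _   = refl
  getR-∷ʳ-≢ (_ ∷ xs) {i = zero}  _   = refl
  getR-∷ʳ-≢ (_ ∷ xs) {i = suc i} i≢n = getR-∷ʳ-≢ xs (λ i≡n → i≢n (cong suc i≡n))

module _ {X Y : Set} (f : X → Y) where

  map-setR : ∀ (xs : List X) i y → map f (setR xs i y) ≡ setR (map f xs) i (f y)
  map-setR []       i       y = refl
  map-setR (x ∷ xs) zero    y = refl
  map-setR (x ∷ xs) (suc i) y = cong (f x ∷_) (map-setR xs i y)

  getR-map : ∀ (xs : List X) i → getR (map f xs) i ≡ Maybe.map f (getR xs i)
  getR-map []       i       = refl
  getR-map (x ∷ xs) zero    = refl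
  getR-map (x ∷ xs) (suc i) = getR-map xs i

∧-split : ∀ {x y} → T (x ∧ y) → T x × T y
∧-split = Equivalence.to T-∧

module _ {A : Set} where

  initialised-read : ∀ (rs : List (Maybe A)) i → T (rdB (map is-just rs) i) → ∃ λ a → getR rs i ≡ just (just a)
  initialised-read (just a ∷ rs) zero    _  = a , refl
  initialised-read (x ∷ rs)      (suc i) rd = initialised-read rs i rd

  initialised-transport : ∀ {rs rs′ : List (Maybe A)} i {a} → map is-just rs ≡ map is-just rs′ →
                          getR rs i ≡ just (just a) → ∃ λ b → getR rs′ i ≡ just (just b)
  initialised-transport {_ ∷ _} {just b ∷ _}  zero    _  _ = b , refl
  initialised-transport {_ ∷ _} {_ ∷ _}       (suc i) eq g = initialised-transport i (∷-injectiveʳ eq) g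
  initialised-transport {just _ ∷ _} {nothing ∷ _} zero () refl

  is-just-setR : ∀ (rs : List (Maybe A)) i {a c} → getR rs i ≡ just (just a) →
                 map is-just (setR rs i (just c)) ≡ map is-just rs
  is-just-setR rs i {c = c} g = begin
    map is-just (setR rs i (just c))  ≡⟨ map-setR is-just rs i (just c) ⟩
    setR (map is-just rs) i true      ≡⟨ setR-getR (map is-just rs) i initialised ⟩
    map is-just rs                    ∎
    where
    open ≡-Reasoning
    initialised : getR (map is-just rs) i ≡ just true
    initialised = trans (getR-map is-just rs i) (cong (Maybe.map is-just) g)

  is-just-setR₂ : ∀ {rs rs′ : List (Maybe A)} i {a b} → map is-just rs ≡ map is-just rs′ →
                  map is-just (setR rs i (just a)) ≡ map is-just (setR rs′ i (just b))
  is-just-setR₂ {rs} {rs′} i {a} {b} eq = begin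
    map is-just (setR rs i (just a))   ≡⟨ map-setR is-just rs i (just a) ⟩
    setR (map is-just rs) i true       ≡⟨ cong (λ ini → setR ini i true) eq ⟩
    setR (map is-just rs′) i true      ≡⟨ map-setR is-just rs′ i (just b) ⟨
    map is-just (setR rs′ i (just b))  ∎
    where open ≡-Reasoning

choose : {A : Set} → ℕ → A → A → A
choose zero    x y = x
choose (suc _) x y = y

choose-intro : ∀ {A : Set} {P : A → Set} n {x y} → P x → P y → P (choose n x y)
choose-intro zero    px py = px
choose-intro (suc _) px py = py

module Machine (S : AddrSpace) (C : Coding S) where
  open AddrSpace S
  open Sem S C

  -- Reduction

  raw-injective : ∀ {M N} → raw M ≡ raw N → M ≡ N
  raw-injective {mk r v} {mk .r w} refl = cong (mk r) (T-irrelevant v w)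

  ＠-assoc : ∀ M t t′ → (M ＠ t) ＠ t′ ≡ M ＠ (t ++ t′)
  ＠-assoc (mk ⟨ rs , p , t₀ ⟩ _) t t′ = raw-injective (cong ⟨ rs , p ,_⟩ (++-assoc t₀ t t′))

  ＠-identityʳ : ∀ M → M ＠ [] ≡ M
  ＠-identityʳ (mk ⟨ rs , p , t ⟩ _) = raw-injective (cong ⟨ rs , p ,_⟩ (++-identityʳ t))

  dec-ι : ∀ n → dec (ι n) ≡ num n
  dec-ι n = trans (cong dec (sym (enc-num n))) (dec-enc (num n))

  num-irreducible : ∀ {n X} → ¬ (num n ⟶ X)
  num-irreducible (load () _ _)

  ι-irreducible : ∀ {n a X} → ι n ≡ a → ¬ (dec a ⟶ X)
  ι-irreducible {n} refl s = num-irreducible (subst (_⟶ _) (dec-ι n) s)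

  read-unique : ∀ {r : Maybe (Maybe 𝔸)} {a b} → r ≡ just (just a) → r ≡ just (just b) → a ≡ b
  read-unique g g′ with refl ← trans (sym g) g′ = refl

  ⟶-deterministic : ∀ {M N₁ N₂} → M ⟶ N₁ → M ⟶ N₂ → N₁ ≡ N₂
  ⟶-deterministic {mk _ _} (load refl refl e) (load refl refl e′) = raw-injective (trans e (sym e′))
  ⟶-deterministic {mk _ _} (app refl g₁ g₂ e) (app refl g₁′ g₂′ e′)
    with refl ← read-unique g₁ g₁′ | refl ← read-unique g₂ g₂′ =
    raw-injective (trans e (sym e′))
  ⟶-deterministic {mk _ _} (predN refl g e) (predN refl g′ e′)
    with refl ← ι-inj (read-unique g g′) = raw-injective (trans e (sym e′))
  ⟶-deterministic {mk _ _} (succN refl g e) (succN refl g′ e′)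
    with refl ← ι-inj (read-unique g g′) = raw-injective (trans e (sym e′))
  ⟶-deterministic {mk _ _} (testZ refl _ g e) (testZ refl _ g′ e′)
    with refl ← read-unique g g′ = raw-injective (trans e (sym e′))
  ⟶-deterministic {mk _ _} (testZ refl g _ _) (testS refl g′ _ _)
    with () ← ι-inj (read-unique g g′)
  ⟶-deterministic {mk _ _} (testS refl g _ _) (testZ refl g′ _ _)
    with () ← ι-inj (read-unique g g′)
  ⟶-deterministic {mk _ _} (testS refl _ g e) (testS refl _ g′ e′)
    with refl ← read-unique g g′ = raw-injective (trans e (sym e′))
  ⟶-deterministic {mk _ _} (predR refl g s e) (predR refl g′ s′ e′)
    with refl ← read-unique g g′ with refl ← ⟶-deterministic s s′ = raw-injective (trans e (sym e′))
  ⟶-deterministic {mk _ _} (succR refl g s e) (succR refl g′ s′ e′)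
    with refl ← read-unique g g′ with refl ← ⟶-deterministic s s′ = raw-injective (trans e (sym e′))
  ⟶-deterministic {mk _ _} (testR refl g s e) (testR refl g′ s′ e′)
    with refl ← read-unique g g′ with refl ← ⟶-deterministic s s′ = raw-injective (trans e (sym e′))
  ⟶-deterministic {mk _ _} (predN refl g _) (predR refl g′ s _) = ⊥-elim (ι-irreducible (read-unique g g′) s)
  ⟶-deterministic {mk _ _} (predR refl g′ s _) (predN refl g _) = ⊥-elim (ι-irreducible (read-unique g g′) s)
  ⟶-deterministic {mk _ _} (succN refl g _) (succR refl g′ s _) = ⊥-elim (ι-irreducible (read-unique g g′) s)
  ⟶-deterministic {mk _ _} (succR refl g′ s _) (succN refl g _) = ⊥-elim (ι-irreducible (read-unique g g′) s)
  ⟶-deterministic {mk _ _} (testZ refl g _ _) (testR refl g′ s _) = ⊥-elim (ι-irreducible (read-unique g g′) s)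
  ⟶-deterministic {mk _ _} (testS refl g _ _) (testR refl g′ s _) = ⊥-elim (ι-irreducible (read-unique g g′) s)
  ⟶-deterministic {mk _ _} (testR refl g′ s _) (testZ refl g _ _) = ⊥-elim (ι-irreducible (read-unique g g′) s)
  ⟶-deterministic {mk _ _} (testR refl g′ s _) (testS refl g _ _) = ⊥-elim (ι-irreducible (read-unique g g′) s)
  ⟶-deterministic {mk _ _} (callS refl g e) (callS refl g′ e′)
    with refl ← read-unique g g′ = trans e (sym e′)

  ⟶-＠ : ∀ {M N} t → M ⟶ N → M ＠ t ⟶ N ＠ t
  ⟶-＠ {mk _ _} t (load  {N = mk _ _} refl refl refl) = load refl refl refl
  ⟶-＠ {mk _ _} t (app   {N = mk _ _} refl g g′ refl) = app refl g g′ refl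
  ⟶-＠ {mk _ _} t (predN {N = mk _ _} refl g refl)    = predN refl g refl
  ⟶-＠ {mk _ _} t (succN {N = mk _ _} refl g refl)    = succN refl g refl
  ⟶-＠ {mk _ _} t (testZ {N = mk _ _} refl g g′ refl) = testZ refl g g′ refl
  ⟶-＠ {mk _ _} t (testS {N = mk _ _} refl g g′ refl) = testS refl g g′ refl
  ⟶-＠ {mk _ _} t (predR {N = mk _ _} refl g s refl)  = predR refl g s refl
  ⟶-＠ {mk _ _} t (succR {N = mk _ _} refl g s refl)  = succR refl g s refl
  ⟶-＠ {mk _ _} t (testR {N = mk _ _} refl g s refl)  = testR refl g s refl
  ⟶-＠ {mk ⟨ _ , _ , t₀ ⟩ _} t (callS {a = a} refl g refl) = callS refl g (＠-assoc (dec a) t₀ t)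

  ⟶*-＠ : ∀ {M N} t → M ⟶* N → M ＠ t ⟶* N ＠ t
  ⟶*-＠ t ε        = ε
  ⟶*-＠ t (s ◅ ss) = ⟶-＠ t s ◅ ⟶*-＠ t ss

  infix 4 _⟶[_]_
  data _⟶[_]_ : EAM → ℕ → EAM → Set where
    ε   : ∀ {M} → M ⟶[ 0 ] M
    _◅_ : ∀ {M M₁ N m} → M ⟶ M₁ → M₁ ⟶[ m ] N → M ⟶[ suc m ] N

  ⟶[]⇒⟶* : ∀ {M N m} → M ⟶[ m ] N → M ⟶* N
  ⟶[]⇒⟶* ε        = ε
  ⟶[]⇒⟶* (s ◅ ss) = s ◅ ⟶[]⇒⟶* ss

  ⟶*⇒⟶[] : ∀ {M N} → M ⟶* N → ∃ λ m → M ⟶[ m ] N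
  ⟶*⇒⟶[] ε        = 0 , ε
  ⟶*⇒⟶[] (s ◅ ss) = let m , ss′ = ⟶*⇒⟶[] ss in suc m , s ◅ ss′

  ⟶[]-num-step⁻¹ : ∀ {M M₁ m n} → M ⟶ M₁ → M ⟶[ m ] num n →
                   ∃ λ m′ → m ≡ suc m′ × M₁ ⟶[ m′ ] num n
  ⟶[]-num-step⁻¹ s ε = ⊥-elim (num-irreducible s)
  ⟶[]-num-step⁻¹ s (s′ ◅ ss) with refl ← ⟶-deterministic s s′ = _ , refl , ss

  ⟶*-num-step⁻¹ : ∀ {M M₁ n} → M ⟶ M₁ → M ⟶* num n → M₁ ⟶* num n
  ⟶*-num-step⁻¹ s ε = ⊥-elim (num-irreducible s)
  ⟶*-num-step⁻¹ s (s′ ◅ ss) with refl ← ⟶-deterministic s s′ = ss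

  ⇒*-∷ʳ : ∀ αs β γ → (αs ++ [ β ]) ⇒* γ ≡ αs ⇒* (β ⇒ γ)
  ⇒*-∷ʳ []       β γ = refl
  ⇒*-∷ʳ (α ∷ αs) β γ = cong (α ⇒_) (⇒*-∷ʳ αs β γ)

  ⊩-＠ : ∀ {Δ r p t a β γ} → Δ ⊩[ r ] (p , t) ⦂ (β ⇒ γ) → 𝒟 β a → Δ ⊩[ r ] (p , t ++ [ a ]) ⦂ γ
  ⊩-＠ (loadE D)          da = loadT D da
  ⊩-＠ (loadT D db)       da = loadT (⊩-＠ D da) db
  ⊩-＠ (predT e D)        da = predT e (⊩-＠ D da)
  ⊩-＠ (succT e D)        da = succT e (⊩-＠ D da)
  ⊩-＠ (testT e e′ e″ D)  da = testT e e′ e″ (⊩-＠ D da)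
  ⊩-＠ (appT e e′ D)      da = appT e e′ (⊩-＠ D da)
  ⊩-＠ {β = β} {γ} (callT {αs = αs} args e) da =
    callT (Pointwise.++⁺ args (da ∷ [])) (trans e (cong just (sym (⇒*-∷ʳ αs β γ))))

  dec-yA : dec yA ≡ 𝖸
  dec-yA = trans (cong dec (sym enc-Y)) (dec-enc 𝖸)

  𝒟-yA : ∀ α → 𝒟 ((α ⇒ α) ⇒ α) yA
  𝒟-yA α = subst (_⦂ ((α ⇒ α) ⇒ α)) (sym dec-yA) (YT α)

  ⦂-＠ : ∀ {M a β γ} → M ⦂ (β ⇒ γ) → 𝒟 β a → M ＠ [ a ] ⦂ γ
  ⦂-＠ (YT α) da = eamT {Δ = ∅ctx} (nullR (nullR emptyR))
    (loadT (loadT (appT refl refl (appT refl refl (callT [] refl))) da) (𝒟-yA α))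
  ⦂-＠ {mk _ _} (eamT R D) da = eamT R (⊩-＠ D da)

  𝒟-· : ∀ {a b β γ} → 𝒟 (β ⇒ γ) a → 𝒟 β b → 𝒟 γ (a · b)
  𝒟-· da db = subst (_⦂ _) (sym (dec-enc _)) (⦂-＠ da db)

  -- A record rather than T (validRaw …), so that rs and p can be inferred from it.
  record Valid (rs : Regs) (p : Prog) : Set where
    constructor valid⟨_⟩
    field holds : T (validRaw ⟨ rs , p , [] ⟩)

  Valid-transport : ∀ {rs rs′ p} → map is-just rs ≡ map is-just rs′ → Valid rs p → Valid rs′ p
  Valid-transport {[]}    {[]}        _  v          = v
  Valid-transport {_ ∷ _} {_ ∷ _} {p} eq valid⟨ v ⟩ = valid⟨ subst (λ ini → T (validP ini p)) eq v ⟩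

  Valid-setR : ∀ rs i p {a} → T (not (null rs)) → T (validP (setR (map is-just rs) i true) p) →
               Valid (setR rs i (just a)) p
  Valid-setR rs i p {a} nonempty v = valid⟨ subst T (sym written) (Equivalence.from T-∧ (nonempty , v)) ⟩
    where
    written : validRaw ⟨ setR rs i (just a) , p , [] ⟩ ≡
              not (null rs) ∧ validP (setR (map is-just rs) i true) p
    written = cong₂ _∧_ (cong not (null-setR rs i))
                        (cong (λ ini → validP ini p) (map-setR is-just rs i (just a)))

  Valid-overwrite : ∀ {rs i p a c} → getR rs i ≡ just (just a) → Valid rs p → Valid (setR rs i (just c)) p
  Valid-overwrite {rs} {i} g = Valid-transport (sym (is-just-setR rs i g))

  Readable : Regs → ℕ → Set
  Readable rs i = ∃ λ a → getR rs i ≡ just (just a)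

  load-valid : ∀ {rs i p} → Valid rs (load i p) → ∀ {c} → Valid (setR rs i (just c)) p
  load-valid {rs} {i} {p} valid⟨ v ⟩ = let nonempty , vp = ∧-split v in Valid-setR rs i p nonempty vp

  app-valid : ∀ {rs i j l b} → Valid rs (body (app i j l b)) →
              Readable rs i × Readable rs j × (∀ {c} → Valid (setR rs l (just c)) (body b))
  app-valid {rs} {i} {j} {l} {b} valid⟨ v ⟩ =
    let nonempty , v₁ = ∧-split v ; rdᵢ , v₂ = ∧-split v₁
        rdⱼ , v₃ = ∧-split v₂ ; _ , vb = ∧-split v₃
    in initialised-read rs i rdᵢ , initialised-read rs j rdⱼ , Valid-setR rs l (body b) nonempty vb

  pred-valid : ∀ {rs i j b} → Valid rs (body (pred i j b)) →
               Readable rs i × (∀ {c} → Valid (setR rs j (just c)) (body b))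
  pred-valid {rs} {i} {j} {b} valid⟨ v ⟩ =
    let nonempty , v₁ = ∧-split v ; rdᵢ , v₂ = ∧-split v₁ ; _ , vb = ∧-split v₂
    in initialised-read rs i rdᵢ , Valid-setR rs j (body b) nonempty vb

  succ-valid : ∀ {rs i j b} → Valid rs (body (succ i j b)) →
               Readable rs i × (∀ {c} → Valid (setR rs j (just c)) (body b))
  succ-valid {rs} {i} {j} {b} valid⟨ v ⟩ =
    let nonempty , v₁ = ∧-split v ; rdᵢ , v₂ = ∧-split v₁ ; _ , vb = ∧-split v₂
    in initialised-read rs i rdᵢ , Valid-setR rs j (body b) nonempty vb

  test-valid : ∀ {rs i j k l b} → Valid rs (body (test i j k l b)) →
               Readable rs i × Readable rs j × Readable rs k × (∀ {c} → Valid (setR rs l (just c)) (body b))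
  test-valid {rs} {i} {j} {k} {l} {b} valid⟨ v ⟩ =
    let nonempty , v₁ = ∧-split v ; rdᵢ , v₂ = ∧-split v₁
        rdⱼ , v₃ = ∧-split v₂ ; rdₖ , v₄ = ∧-split v₃ ; _ , vb = ∧-split v₄
    in initialised-read rs i rdᵢ , initialised-read rs j rdⱼ , initialised-read rs k rdₖ ,
       Valid-setR rs l (body b) nonempty vb

  call-valid : ∀ {rs i} → Valid rs (body (call i)) → Readable rs i
  call-valid {rs} {i} valid⟨ v ⟩ = initialised-read rs i (proj₂ (∧-split v))

  -- Step-indexed approximation

  Approx : ℕ → Ty → EAM → EAM → Set
  Approx k int     M N = ∀ {n m} → m ≤ k → M ⟶[ m ] num n → N ⟶* num n
  Approx k (α ⇒ β) M N = ∀ {j} → j ≤ k → ∀ {a b} → 𝒟 α a → 𝒟 α b → Approx j α (dec a) (dec b) →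
                         Approx j β (M ＠ [ a ]) (N ＠ [ b ])

  Approx-mono : ∀ α {j k M N} → j ≤ k → Approx k α M N → Approx j α M N
  Approx-mono int     j≤k M≲N m≤j = M≲N (≤-trans m≤j j≤k)
  Approx-mono (α ⇒ β) j≤k M≲N i≤j = M≲N (≤-trans i≤j j≤k)

  Approx-int-refl : ∀ {k M} → Approx k int M M
  Approx-int-refl _ = ⟶[]⇒⟶*

  Approx-step : ∀ α {k M M₁ N N₁} → M ⟶ M₁ → N ⟶* N₁ → Approx (ℕ.pred k) α M₁ N₁ → Approx k α M N
  Approx-step int s ss M≲N m≤k M⟶n with m′ , refl , M₁⟶n ← ⟶[]-num-step⁻¹ s M⟶n =
    ss ◅◅ M≲N (pred-mono-≤ m≤k) M₁⟶n
  Approx-step (α ⇒ β) s ss M≲N j≤k {a} {b} da db a≲b =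
    Approx-step β (⟶-＠ [ a ] s) (⟶*-＠ [ b ] ss) (M≲N (pred-mono-≤ j≤k) da db (Approx-mono α pred[n]≤n a≲b))

  Approx-step′ : ∀ α {k M M₁ N N₁} → M ⟶ M₁ → N ⟶* N₁ → Approx k α M₁ N₁ → Approx k α M N
  Approx-step′ α s ss M≲N = Approx-step α s ss (Approx-mono α pred[n]≤n M≲N)

  Approx-stepsʳ : ∀ α {k M N N₁} → N ⟶* N₁ → Approx k α M N₁ → Approx k α M N
  Approx-stepsʳ int     ss M≲N m≤k M⟶n = ss ◅◅ M≲N m≤k M⟶n
  Approx-stepsʳ (α ⇒ β) ss M≲N j≤k {b = b} da db a≲b = Approx-stepsʳ β (⟶*-＠ [ b ] ss) (M≲N j≤k da db a≲b)

  Approx-steps : ∀ α {k M M₁ N N₁} → M ⟶* M₁ → N ⟶* N₁ → Approx k α M₁ N₁ → Approx k α M N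
  Approx-steps α ε        ss M≲N = Approx-stepsʳ α ss M≲N
  Approx-steps α (s ◅ ss) ss′ M≲N = Approx-step′ α s ss′ (Approx-steps α ss ε M≲N)

  Approx-zero : ∀ α {M M₁ N} → M ⟶ M₁ → Approx 0 α M N
  Approx-zero int     s z≤n ε = ⊥-elim (num-irreducible s)
  Approx-zero (α ⇒ β) s z≤n {a} _ _ _ = Approx-zero β (⟶-＠ [ a ] s)

  Y-loaded : 𝔸 → EAM
  Y-loaded f = mk ⟨ just yA ∷ nothing ∷ [] , load 1 (body (app 0 1 0 (app 1 0 1 (call 1)))) , f ∷ [] ⟩ _

  Y-load : ∀ f → 𝖸 ＠ [ f ] ⟶ Y-loaded f
  Y-load f = load refl refl refl

  Y-unfold : ∀ f → Y-loaded f ⟶* dec f ＠ [ yA · f ]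
  Y-unfold f = load refl refl refl ◅ app refl refl refl refl ◅ app refl refl refl refl
             ◅ callS refl refl (sym (trans (＠-identityʳ _) (dec-enc _))) ◅ ε

  dec-yA· : ∀ f → dec (yA · f) ≡ 𝖸 ＠ [ f ]
  dec-yA· f = trans (dec-enc _) (cong (_＠ [ f ]) dec-yA)

  Approx-Y : ∀ α j {f g} → 𝒟 (α ⇒ α) f → 𝒟 (α ⇒ α) g → Approx j (α ⇒ α) (dec f) (dec g) →
             Approx j α (𝖸 ＠ [ f ]) (𝖸 ＠ [ g ])
  Approx-Y α zero    {f}     df dg f≲g = Approx-zero α (Y-load f)
  Approx-Y α (suc j) {f} {g} df dg f≲g =
    Approx-step α (Y-load f) (Y-load g ◅ ε) (Approx-steps α (Y-unfold f) (Y-unfold g)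
      (f≲g (n≤1+n j) (𝒟-Y df) (𝒟-Y dg)
        (subst₂ (Approx j α) (sym (dec-yA· f)) (sym (dec-yA· g))
          (Approx-Y α j df dg (Approx-mono (α ⇒ α) (n≤1+n j) f≲g)))))
    where
    𝒟-Y : ∀ {h} → 𝒟 (α ⇒ α) h → 𝒟 α (yA · h)
    𝒟-Y = 𝒟-· (𝒟-yA α)

  -- Evaluation of inspected registers

  regs : EAM → Regs
  regs M = Raw.regs (raw M)

  prog : EAM → Prog
  prog M = Raw.prog (raw M)

  setReg : (M : EAM) (i : ℕ) (c : 𝔸) {a : 𝔸} → getR (regs M) i ≡ just (just a) → EAM
  setReg (mk ⟨ rs , p , t ⟩ v) i c g =
    mk ⟨ setR rs i (just c) , p , t ⟩ (Valid.holds (Valid-overwrite {rs} {i} {p} g valid⟨ v ⟩))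

  setReg-read : ∀ M i c {a} (g : getR (regs M) i ≡ just (just a)) → getR (regs (setReg M i c g)) i ≡ just (just c)
  setReg-read M i c g = getR∘setR (regs M) i g

  setReg-self : ∀ M i {a} (g : getR (regs M) i ≡ just (just a)) → setReg M i a g ≡ M
  setReg-self M i g = raw-injective (cong ⟨_, prog M , Raw.tape (raw M) ⟩ (setR-getR (regs M) i g))

  setReg-setReg : ∀ M i c c′ {a a′} (g : getR (regs M) i ≡ just (just a))
                  (g′ : getR (regs (setReg M i c g)) i ≡ just (just a′)) →
                  setReg (setReg M i c g) i c′ g′ ≡ setReg M i c′ g
  setReg-setReg M i c c′ g g′ = raw-injective (cong ⟨_, prog M , Raw.tape (raw M) ⟩ (setR-setR (regs M) i))

  setReg-＠ : ∀ M x i c {a} (g : getR (regs M) i ≡ just (just a)) →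
             setReg (M ＠ [ x ]) i c g ≡ setReg M i c g ＠ [ x ]
  setReg-＠ (mk _ _) x i c g = raw-injective refl

  test-step : ∀ {M N i j k l b n c} → prog M ≡ body (test i j k l b) → getR (regs M) i ≡ just (just (ι n)) →
              getR (regs M) (choose n j k) ≡ just (just c) →
              raw N ≡ ⟨ setR (regs M) l (just c) , body b , Raw.tape (raw M) ⟩ → M ⟶ N
  test-step {n = zero}  = testZ
  test-step {n = suc _} = testS

  data Inspects : Prog → ℕ → Set where
    pred : ∀ {i j b}     → Inspects (body (pred i j b)) i
    succ : ∀ {i j b}     → Inspects (body (succ i j b)) i
    test : ∀ {i j k l b} → Inspects (body (test i j k l b)) i

  inspected-step : ∀ {M i a X} → Inspects (prog M) i → (g : getR (regs M) i ≡ just (just a)) →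
                   dec a ⟶ X → M ⟶ setReg M i (enc X) g
  inspected-step {mk _ _} pred g s = predR refl g s refl
  inspected-step {mk _ _} succ g s = succR refl g s refl
  inspected-step {mk _ _} test g s = testR refl g s refl

  inspected-step⁻¹ : ∀ {M N i a} → Inspects (prog M) i → (g : getR (regs M) i ≡ just (just a)) → M ⟶ N →
                     (∃ λ n → a ≡ ι n) ⊎ (∃ λ X → dec a ⟶ X × N ≡ setReg M i (enc X) g)
  inspected-step⁻¹ {mk _ _} pred g (predN refl g′ _)   = inj₁ (_ , read-unique g g′)
  inspected-step⁻¹ {mk _ _} succ g (succN refl g′ _)   = inj₁ (_ , read-unique g g′)
  inspected-step⁻¹ {mk _ _} test g (testZ refl g′ _ _) = inj₁ (_ , read-unique g g′)
  inspected-step⁻¹ {mk _ _} test g (testS refl g′ _ _) = inj₁ (_ , read-unique g g′)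
  inspected-step⁻¹ {mk _ _} {mk _ _} pred g (predR refl g′ s refl)
    with refl ← read-unique g g′ = inj₂ (_ , s , raw-injective refl)
  inspected-step⁻¹ {mk _ _} {mk _ _} succ g (succR refl g′ s refl)
    with refl ← read-unique g g′ = inj₂ (_ , s , raw-injective refl)
  inspected-step⁻¹ {mk _ _} {mk _ _} test g (testR refl g′ s refl)
    with refl ← read-unique g g′ = inj₂ (_ , s , raw-injective refl)

  ⟶*-inspected : ∀ {M i a X} → Inspects (prog M) i → (g : getR (regs M) i ≡ just (just a)) →
                 dec a ⟶* X → M ⟶* setReg M i (enc X) g
  ⟶*-inspected ins g = go ins g refl
    where
    go : ∀ {M i a A X} → Inspects (prog M) i → (g : getR (regs M) i ≡ just (just a)) →
         dec a ≡ A → A ⟶* X → M ⟶* setReg M i (enc X) g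
    go {M} {i} {a} ins g refl ε =
      subst (M ⟶*_) (sym (trans (cong (λ c → setReg M i c g) (enc-dec a)) (setReg-self M i g))) ε
    go {M} {i} {X = X} ins g refl (_◅_ {j = X₁} s ss) =
      inspected-step ins g s ◅ subst (setReg M i (enc X₁) g ⟶*_) (setReg-setReg M i (enc X₁) (enc X) g g₁)
                                     (go ins g₁ (dec-enc X₁) ss)
      where g₁ = setReg-read M i (enc X₁) g

  ⟶[]-inspected⁻¹ : ∀ {M i a m n″} → Inspects (prog M) i → (g : getR (regs M) i ≡ just (just a)) →
                    M ⟶[ m ] num n″ →
                    ∃₂ λ n m₁ → ∃ λ m₂ → dec a ⟶[ m₁ ] num n × setReg M i (ι n) g ⟶[ m₂ ] num n″ × m₁ + m₂ ≡ m
  ⟶[]-inspected⁻¹ () g ε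
  ⟶[]-inspected⁻¹ {M} {i} ins g (s ◅ ss) with inspected-step⁻¹ ins g s
  ... | inj₁ (n , refl) =
    n , 0 , _ , subst (_⟶[ 0 ] num n) (sym (dec-ι n)) ε ,
    subst (_⟶[ _ ] _) (sym (setReg-self M i g)) (s ◅ ss) , refl
  ... | inj₂ (X , s′ , refl) =
    let gₓ = setReg-read M i (enc X) g
        n , m₁ , m₂ , a⟶n , M⟶n″ , m₁+m₂≡m = ⟶[]-inspected⁻¹ ins gₓ ss
    in n , suc m₁ , m₂ , s′ ◅ subst (_⟶[ m₁ ] num n) (dec-enc X) a⟶n ,
       subst (_⟶[ m₂ ] num _) (setReg-setReg M i (enc X) (ι n) g gₓ) M⟶n″ , cong suc m₁+m₂≡m

  Approx-inspected : ∀ α k {M M′ i a a′} → Inspects (prog M) i → Inspects (prog M′) i →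
                     (g : getR (regs M) i ≡ just (just a)) (g′ : getR (regs M′) i ≡ just (just a′)) →
                     Approx k int (dec a) (dec a′) →
                     (∀ n → Approx k α (setReg M i (ι n) g) (setReg M′ i (ι n) g′)) → Approx k α M M′
  Approx-inspected int k {M′ = M′} {i} ins ins′ g g′ a≲a′ M≲M′ m≤k M⟶n″
    with n , m₁ , m₂ , a⟶n , Mₙ⟶n″ , refl ← ⟶[]-inspected⁻¹ ins g M⟶n″ =
    subst (λ c → M′ ⟶* setReg M′ i c g′) (enc-num n)
          (⟶*-inspected ins′ g′ (a≲a′ (≤-trans (m≤m+n m₁ m₂) m≤k) a⟶n))
    ◅◅ M≲M′ n (≤-trans (m≤n+m m₂ m₁) m≤k) Mₙ⟶n″
  Approx-inspected (β ⇒ γ) k {M} {M′} {i} ins ins′ g g′ a≲a′ M≲M′ {j} j≤k {x} {y} dx dy x≲y =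
    Approx-inspected γ j ins ins′ g g′ (Approx-mono int j≤k a≲a′)
      (λ n → subst₂ (Approx j γ) (sym (setReg-＠ M x i (ι n) g)) (sym (setReg-＠ M′ y i (ι n) g′))
                    (M≲M′ n j≤k dx dy x≲y))

  -- The fundamental lemma

  ∶=-self : ∀ {Δ i τ} → Δ i ≡ just τ → ∀ l → (Δ [ i ∶= τ ]) l ≡ Δ l
  ∶=-self {i = i} Δi≡τ l with l ≟ i
  ... | yes refl = sym Δi≡τ
  ... | no _     = refl

  record Related (k : ℕ) (τ : Ty) (a b : 𝔸) : Set where
    constructor related
    field
      typedˡ : 𝒟 τ a
      typedʳ : 𝒟 τ b
      approx : Approx k τ (dec a) (dec b)

  Related-mono : ∀ {j k τ a b} → j ≤ k → Related k τ a b → Related j τ a b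
  Related-mono {τ = τ} j≤k (related da db a≲b) = related da db (Approx-mono τ j≤k a≲b)

  𝒟-ι : ∀ n → 𝒟 int (ι n)
  𝒟-ι n = subst (_⦂ int) (sym (dec-ι n)) (numT n)

  Related-ι : ∀ {k} n → Related k int (ι n) (ι n)
  Related-ι n = related (𝒟-ι n) (𝒟-ι n) Approx-int-refl

  Related-· : ∀ {k α β a₁ a₂ b₁ b₂} → Related k (α ⇒ β) a₁ b₁ → Related k α a₂ b₂ →
              Related k β (a₁ · a₂) (b₁ · b₂)
  Related-· {k} {β = β} (related d₁ d₁′ r₁) (related d₂ d₂′ r₂) =
    related (𝒟-· d₁ d₂) (𝒟-· d₁′ d₂′)
            (subst₂ (Approx k β) (sym (dec-enc _)) (sym (dec-enc _)) (r₁ ≤-refl d₂ d₂′ r₂))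

  record RegsRel (k : ℕ) (Δ : Ctx) (rs rs′ : Regs) : Set where
    field
      same-init : map is-just rs ≡ map is-just rs′
      lookup    : ∀ {i τ a} → Δ i ≡ just τ → getR rs i ≡ just (just a) →
                  ∃ λ b → getR rs′ i ≡ just (just b) × Related k τ a b
  open RegsRel

  RegsRel-mono : ∀ {j k Δ rs rs′} → j ≤ k → RegsRel k Δ rs rs′ → RegsRel j Δ rs rs′
  RegsRel-mono j≤k R .same-init = R .same-init
  RegsRel-mono j≤k R .lookup Δi g = let b , g′ , r = R .lookup Δi g in b , g′ , Related-mono j≤k r

  RegsRel-write : ∀ {k Δ rs rs′ i τ a b} → Related k τ a b → RegsRel k Δ rs rs′ →
                  RegsRel k (Δ [ i ∶= τ ]) (setR rs i (just a)) (setR rs′ i (just b))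
  RegsRel-write {i = i} r R .same-init = is-just-setR₂ i (R .same-init)
  RegsRel-write {Δ = Δ} {rs} {rs′} {i} r R .lookup {l} Δl g with l ≟ i
  ... | yes refl with refl ← Δl | refl ← getR∘setR-just rs i g =
    let b′ , g′ = initialised-transport i (is-just-setR₂ i (R .same-init)) g
    in _ , trans g′ (cong just (getR∘setR-just rs′ i g′)) , r
  ... | no l≢i =
    let b′ , g′ , r′ = R .lookup Δl (trans (sym (getR∘setR′ rs l≢i)) g)
    in b′ , trans (getR∘setR′ rs′ l≢i) g′ , r′

  RegsRel-overwrite : ∀ {k Δ rs rs′ i τ a b} → Δ i ≡ just τ → Related k τ a b → RegsRel k Δ rs rs′ →
                      RegsRel k Δ (setR rs i (just a)) (setR rs′ i (just b))
  RegsRel-overwrite Δi r R .same-init = RegsRel-write r R .same-init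
  RegsRel-overwrite Δi r R .lookup {l} Δl = RegsRel-write r R .lookup (trans (∶=-self Δi l) Δl)

  data TapeRel (k : ℕ) : List Ty → Tape → Tape → Set where
    []  : TapeRel k [] [] []
    _∷_ : ∀ {τ τs a b t t′} → Related k τ a b → TapeRel k τs t t′ →
          TapeRel k (τ ∷ τs) (a ∷ t) (b ∷ t′)

  Approx-＠ : ∀ {k τs α M N t t′} → Approx k (τs ⇒* α) M N → TapeRel k τs t t′ →
             Approx k α (M ＠ t) (N ＠ t′)
  Approx-＠ {k} {α = α} {M} {N} M≲N [] = subst₂ (Approx k α) (sym (＠-identityʳ M)) (sym (＠-identityʳ N)) M≲N
  Approx-＠ {k} {α = α} {M} {N} M≲N (_∷_ {a = a} {b} {t} {t′} (related da db a≲b) rs) =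
    subst₂ (Approx k α) (＠-assoc M [ a ] t) (＠-assoc N [ b ] t′) (Approx-＠ (M≲N ≤-refl da db a≲b) rs)

  tapeTypes : ∀ {Δ r p t α} → Δ ⊩[ r ] (p , t) ⦂ α → List Ty
  tapeTypes (loadE D)             = []
  tapeTypes (loadT {β = β} D _)   = β ∷ tapeTypes D
  tapeTypes (predT _ D)           = tapeTypes D
  tapeTypes (succT _ D)           = tapeTypes D
  tapeTypes (testT _ _ _ D)       = tapeTypes D
  tapeTypes (appT _ _ D)          = tapeTypes D
  tapeTypes (callT {αs = αs} _ _) = αs

  TapeRel-[] : ∀ {Δ r p α k} (D : Δ ⊩[ r ] (p , []) ⦂ α) → TapeRel k (tapeTypes D) [] []
  TapeRel-[] (loadE D)       = []
  TapeRel-[] (predT _ D)     = TapeRel-[] D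
  TapeRel-[] (succT _ D)     = TapeRel-[] D
  TapeRel-[] (testT _ _ _ D) = TapeRel-[] D
  TapeRel-[] (appT _ _ D)    = TapeRel-[] D
  TapeRel-[] (callT [] _)    = []

  fundamental-⊩ : ∀ {Δ r p t α} (D : Δ ⊩[ r ] (p , t) ⦂ α) k {rs rs′ t′}
                  (v : Valid rs p) (v′ : Valid rs′ p) → RegsRel k Δ rs rs′ → TapeRel k (tapeTypes D) t t′ →
                  Approx k α (mk ⟨ rs , p , t ⟩ (Valid.holds v)) (mk ⟨ rs′ , p , t′ ⟩ (Valid.holds v′))
  fundamental-⊩ (loadE {α = α} D) k v v′ R [] j≤k dx dy x≲y =
    Approx-step′ α (load refl refl refl) (load refl refl refl ◅ ε)
      (fundamental-⊩ D _ (load-valid v) (load-valid v′) (RegsRel-write (related dx dy x≲y) (RegsRel-mono j≤k R))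
                     (TapeRel-[] D))
  fundamental-⊩ (loadT {α = α} D _) k v v′ R (r ∷ T) =
    Approx-step′ α (load refl refl refl) (load refl refl refl ◅ ε)
      (fundamental-⊩ D k (load-valid v) (load-valid v′) (RegsRel-write r R) T)
  fundamental-⊩ (appT {δ = δ} Δi Δj D) k v v′ R T =
    let (_ , gᵢ) , (_ , gⱼ) , vb = app-valid v
        _ , _ , vb′ = app-valid v′
        _ , gᵢ′ , rᵢ = R .lookup Δi gᵢ
        _ , gⱼ′ , rⱼ = R .lookup Δj gⱼ
    in Approx-step′ δ (app refl gᵢ gⱼ refl) (app refl gᵢ′ gⱼ′ refl ◅ ε)
         (fundamental-⊩ D k vb vb′ (RegsRel-write (Related-· rᵢ rⱼ) R) T)
  fundamental-⊩ (callT {α = α} _ Δi) k v v′ R T =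
    let _ , gᵢ = call-valid v
        _ , gᵢ′ , rᵢ = R .lookup Δi gᵢ
    in Approx-step′ α (callS refl gᵢ refl) (callS refl gᵢ′ refl ◅ ε) (Approx-＠ (Related.approx rᵢ) T)
  fundamental-⊩ (predT {i = i} {α = α} Δi D) k {rs} {rs′} v v′ R T =
    let _ , gᵢ = proj₁ (pred-valid v)
        _ , gᵢ′ , rᵢ = R .lookup Δi gᵢ
    in Approx-inspected α k pred pred gᵢ gᵢ′ (Related.approx rᵢ) λ n →
         let _ , vb = pred-valid (Valid-overwrite gᵢ v)
             _ , vb′ = pred-valid (Valid-overwrite gᵢ′ v′)
         in Approx-step′ α (predN refl (getR∘setR rs i gᵢ) refl) (predN refl (getR∘setR rs′ i gᵢ′) refl ◅ ε)
              (fundamental-⊩ D k vb vb′ (RegsRel-write (Related-ι (n ∸ 1)) (RegsRel-overwrite Δi (Related-ι n) R)) T)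
  fundamental-⊩ (succT {i = i} {α = α} Δi D) k {rs} {rs′} v v′ R T =
    let _ , gᵢ = proj₁ (succ-valid v)
        _ , gᵢ′ , rᵢ = R .lookup Δi gᵢ
    in Approx-inspected α k succ succ gᵢ gᵢ′ (Related.approx rᵢ) λ n →
         let _ , vb = succ-valid (Valid-overwrite gᵢ v)
             _ , vb′ = succ-valid (Valid-overwrite gᵢ′ v′)
         in Approx-step′ α (succN refl (getR∘setR rs i gᵢ) refl) (succN refl (getR∘setR rs′ i gᵢ′) refl ◅ ε)
              (fundamental-⊩ D k vb vb′ (RegsRel-write (Related-ι (suc n)) (RegsRel-overwrite Δi (Related-ι n) R)) T)
  fundamental-⊩ (testT {Δ} {i = i} {j} {k′} {β = β} {α} Δi Δj Δk D) k {rs} {rs′} v v′ R T =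
    let (_ , gᵢ) , _ = test-valid v
        _ , gᵢ′ , rᵢ = R .lookup Δi gᵢ
    in Approx-inspected α k test test gᵢ gᵢ′ (Related.approx rᵢ) λ n →
         let Rₙ = RegsRel-overwrite Δi (Related-ι n) R
             _ , rdⱼ , rdₖ , vb = test-valid (Valid-overwrite gᵢ v)
             _ , _ , _ , vb′ = test-valid (Valid-overwrite gᵢ′ v′)
             _ , g = choose-intro {P = Readable (setR rs i (just (ι n)))} n rdⱼ rdₖ
             _ , g′ , r = Rₙ .lookup (choose-intro {P = λ x → Δ x ≡ just β} n Δj Δk) g
         in Approx-step′ α (test-step refl (getR∘setR rs i gᵢ) g refl)
                           (test-step refl (getR∘setR rs′ i gᵢ′) g′ refl ◅ ε)
                           (fundamental-⊩ D k vb vb′ (RegsRel-write r Rₙ) T)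

  mutual
    fundamental : ∀ {M α} → M ⦂ α → ∀ k → Approx k α M M
    fundamental (numT n)              k = Approx-int-refl
    fundamental (YT α)                k j≤k = Approx-Y α _
    fundamental {mk _ v} (eamT RΔ D)  k =
      fundamental-⊩ D k valid⟨ v ⟩ valid⟨ v ⟩ (RegsRel-refl RΔ k) (TapeRel-refl D k)

    Related-refl : ∀ {τ a} → 𝒟 τ a → ∀ k → Related k τ a a
    Related-refl da k = related da da (fundamental da k)

    RegsRel-refl : ∀ {rs Δ} → rs ⊨ Δ → ∀ k → RegsRel k Δ rs rs
    RegsRel-refl RΔ k .same-init = refl
    RegsRel-refl RΔ k .lookup Δi g = _ , g , ⊨-lookup RΔ k Δi g

    ⊨-lookup : ∀ {rs Δ τ a} → rs ⊨ Δ → ∀ k {i} → Δ i ≡ just τ → getR rs i ≡ just (just a) →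
               Related k τ a a
    ⊨-lookup (nullR {R = rs} RΔ) k {i} Δi g with i ≟ length rs
    ... | yes refl with () ← trans (sym g) (getR-∷ʳ-length rs)
    ... | no i≢r = ⊨-lookup RΔ k Δi (trans (sym (getR-∷ʳ-≢ rs i≢r)) g)
    ⊨-lookup (valR {R = rs} RΔ da) k {i} Δi g with i ≟ length rs
    ... | yes refl with refl ← Δi | refl ← read-unique g (getR-∷ʳ-length rs) = Related-refl da k
    ... | no i≢r = ⊨-lookup RΔ k Δi (trans (sym (getR-∷ʳ-≢ rs i≢r)) g)

    TapeRel-refl : ∀ {Δ r p t α} (D : Δ ⊩[ r ] (p , t) ⦂ α) → ∀ k → TapeRel k (tapeTypes D) t t
    TapeRel-refl (loadE D)       k = []
    TapeRel-refl (loadT D da)    k = Related-refl da k ∷ TapeRel-refl D k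
    TapeRel-refl (predT _ D)     k = TapeRel-refl D k
    TapeRel-refl (succT _ D)     k = TapeRel-refl D k
    TapeRel-refl (testT _ _ _ D) k = TapeRel-refl D k
    TapeRel-refl (appT _ _ D)    k = TapeRel-refl D k
    TapeRel-refl (callT args _)  k = Pointwise-refl args k

    Pointwise-refl : ∀ {t αs} → Pointwise (λ a β → 𝒟 β a) t αs → ∀ k → TapeRel k αs t t
    Pointwise-refl []         k = []
    Pointwise-refl (da ∷ das) k = Related-refl da k ∷ Pointwise-refl das k

  -- Observational equivalence

  Approx-trans : ∀ α {j M N P} → Approx j α M N → (∀ k → Approx k α N P) → Approx j α M P
  Approx-trans int M≲N N≲P m≤j M⟶n with m′ , N⟶n ← ⟶*⇒⟶[] (M≲N m≤j M⟶n) = N≲P m′ ≤-refl N⟶n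
  Approx-trans (α ⇒ β) M≲N N≲P j≤k da db a≲b =
    Approx-trans β (M≲N j≤k da db a≲b) (λ k → N≲P k ≤-refl db db (fundamental db k))

  Equiv-sym : ∀ α {M N} → Equiv α M N → Equiv α N M
  Equiv-sym int     M≈N n = mk⇔ (Equivalence.from (M≈N n)) (Equivalence.to (M≈N n))
  Equiv-sym (α ⇒ β) M≈N a b da db a≈b = Equiv-sym β (M≈N b a db da (Equiv-sym α a≈b))

  mutual
    Equiv⇒Approx : ∀ α {M N} → M ⦂ α → Equiv α M N → ∀ k → Approx k α M N
    Equiv⇒Approx int     _  M≈N k _ M⟶n = Equivalence.to (M≈N _) (⟶[]⇒⟶* M⟶n)
    Equiv⇒Approx (α ⇒ β) dM M≈N k {j} j≤k {a} {b} da db a≲b =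
      Approx-trans β (fundamental dM j ≤-refl da db a≲b)
        (Equiv⇒Approx β (⦂-＠ dM db) (M≈N b b db db (Equiv-refl α db)))

    Approx⇒Equiv : ∀ α {M N} → (∀ k → Approx k α M N) → (∀ k → Approx k α N M) → Equiv α M N
    Approx⇒Equiv int     M≲N N≲M n = mk⇔ (converges M≲N) (converges N≲M)
      where
      converges : ∀ {M N} → (∀ k → Approx k int M N) → M ⟶* num n → N ⟶* num n
      converges M≲N M⟶n = let m , M⟶ₘn = ⟶*⇒⟶[] M⟶n in M≲N m ≤-refl M⟶ₘn
    Approx⇒Equiv (α ⇒ β) M≲N N≲M a b da db a≈b =
      Approx⇒Equiv β (λ k → M≲N k ≤-refl da db (Equiv⇒Approx α da a≈b k))
                     (λ k → N≲M k ≤-refl db da (Equiv⇒Approx α db (Equiv-sym α a≈b) k))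

    Equiv-refl : ∀ α {M} → M ⦂ α → Equiv α M M
    Equiv-refl α dM = Approx⇒Equiv α (fundamental dM) (fundamental dM)

  Equiv-trans : ∀ α {M N P} → Equiv α M N → Equiv α N P → Equiv α M P
  Equiv-trans int     M≈N N≈P n = mk⇔ (Equivalence.to (N≈P n) ∘ Equivalence.to (M≈N n))
                                      (Equivalence.from (M≈N n) ∘ Equivalence.from (N≈P n))
  Equiv-trans (α ⇒ β) M≈N N≈P a c da dc a≈c =
    Equiv-trans β (M≈N a c da dc a≈c) (N≈P c c dc dc (Equiv-refl α dc))

  Equiv-step : ∀ α {M M′ N} → M ⟶ M′ → Equiv α M′ N → Equiv α M N
  Equiv-step int     s M′≈N n = mk⇔ (Equivalence.to (M′≈N n) ∘ ⟶*-num-step⁻¹ s)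
                                     ((s ◅_) ∘ Equivalence.from (M′≈N n))
  Equiv-step (α ⇒ β) s M′≈N a b da db a≈b = Equiv-step β (⟶-＠ [ a ] s) (M′≈N a b da db a≈b)

  ⟶⇒Equiv : ∀ α {M N} → N ⦂ α → M ⟶ N → Equiv α M N
  ⟶⇒Equiv α dN s = Equiv-step α s (Equiv-refl α dN)

  𝒟-enc : ∀ {α M} → M ⦂ α → 𝒟 α (enc M)
  𝒟-enc {M = M} dM = subst (_⦂ _) (sym (dec-enc M)) dM

  Equiv-＠-⟶ : ∀ α β {M N₁ N₂} → M ⦂ (α ⇒ β) → N₁ ⦂ α → N₂ ⦂ α → N₁ ⟶ N₂ →
              Equiv β (M ＠ [ enc N₁ ]) (M ＠ [ enc N₂ ])
  Equiv-＠-⟶ α β {N₁ = N₁} {N₂} dM d₁ d₂ s =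
    Equiv-refl (α ⇒ β) dM (enc N₁) (enc N₂) (𝒟-enc d₁) (𝒟-enc d₂)
      (subst₂ (Equiv α) (sym (dec-enc N₁)) (sym (dec-enc N₂)) (⟶⇒Equiv α d₂ s))

lemma5p8 : (S : AddrSpace) (C : Coding S) → let open Sem S C in
    ((α : Ty) → IsEquivalence {A = Typed α} (λ M N → Equiv α (proj₁ M) (proj₁ N)))
    × (∀ {α M N} → M ⦂ α → N ⦂ α → M ⟶ N → Equiv α M N)
    × (∀ {α β M N₁ N₂} → M ⦂ (α ⇒ β) → N₁ ⦂ α → N₂ ⦂ α → N₁ ⟶ N₂ →
         Equiv β (M ＠ [ enc N₁ ]) (M ＠ [ enc N₂ ]))
lemma5p8 S C =
    (λ α → record { refl = λ {M} → Equiv-refl α (proj₂ M) ; sym = Equiv-sym α ; trans = Equiv-trans α })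
  , (λ {α} _ dN → ⟶⇒Equiv α dN)
  , (λ {α} {β} → Equiv-＠-⟶ α β)
  where open Machine S C
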